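{- Let $G$ be a graph that has a clique separator, a proper 2-separator, or a proper $P_3$-separator, and let $G_1,\dots,G_k$ be its blocks of decomposition with respect to this separator (for any admissible choice of the paths used to define them). Then $\mathrm{tw}(G)=\max(\mathrm{tw}(G_1),\dots,\mathrm{tw}(G_k))$.
   Context: Graphs are finite and simple; $\mathrm{tw}$ denotes treewidth. A path means an induced path; an $ab$-path has ends $a,b$; for $X\subseteq V(G)$, an $aXb$-path is an $ab$-path all of whose internal vertices are in $X$. A clique separator of $G$ is a (possibly empty) set $K$ of pairwise adjacent vertices such that $G\setminus K$ has at least two connected components; if $X_1,\dots,X_k$ are these components, the blocks of decomposition are $G[K\cup X_1],\dots,G[K\cup X_k]$. A proper 2-separator of $G$ is a set $\{a,b\}$ of two nonadjacent vertices such that $G\setminus\{a,b\}$ has exactly two components $X,Y$ and, for each $Z\in\{X,Y\}$, $G$ contains an $aZb$-path and $G[Z\cup\{a,b\}]$ is not itself an $ab$-path; its blocks of decomposition are $G_X=G[X\cup\{a,b\}\cup V(Q)]$ and $G_Y=G[V(P)\cup\{a,b\}\cup Y]$, where $Q$ is any $aYb$-path and $P$ is any $aXb$-path. A proper $P_3$-separator of $G$ is a path $acb$ such that $G\setminus\{a,c,b\}$ has exactly two components, named $X,Y$ so that: $G$ contains an $aXb$-path and an $aYb$-path; $c$ has neighbours in both $X$ and $Y$; some $aXb$-path has no internal vertex adjacent to $c$; every $aYb$-path has an internal vertex adjacent to $c$; and neither $G[X\cup\{a,b\}]$ nor $G[Y\cup\{a,b\}]$ is an $ab$-path. Its blocks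 of decomposition are $G_X=G[X\cup\{a,c,b\}\cup V(Q)]$ and $G_Y=G[V(P)\cup\{a,c,b\}\cup Y]$, where $P$ is any $aXb$-path with no internal vertex adjacent to $c$ and $Q$ is any $aYb$-path. -}

module Defs where

open import Data.Nat using (ℕ; zero; suc; _≤_; _<_; _⊔_)
open import Data.Fin using (Fin; zero; suc; toℕ; fromℕ)
open import Data.Bool using (Bool; true; false; T)
open import Data.List using (List; length)
open import Data.List.Membership.Propositional using (_∈_)
open import Data.Product using (Σ; ∃; _×_; _,_)
open import Data.Sum using (_⊎_)
open import Data.Unit using (⊤)
open import Data.Empty using (⊥)
open import Relation.Nullary using (¬_)
open import Relation.Binary.PropositionalEquality using (_≡_; _≢_)

data Walk {A : Set} (R : A → A → Set) (X : A → Set) : A → A → Set where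
  here : ∀ {a} → X a → Walk R X a a
  step : ∀ {a b c} → X a → R a b → Walk R X b c → Walk R X a c

ConnectedIn : {A : Set} → (A → A → Set) → (A → Set) → Set
ConnectedIn {A} R X = ∀ (a b : A) → X a → X b → Walk R X a b

Everything : {A : Set} → A → Set
Everything _ = ⊤

record IsTree {m : ℕ} (E : Fin (suc m) → Fin (suc m) → Set) : Set where
  field
    E-sym       : ∀ {x y} → E x y → E y x
    E-irrefl    : ∀ {x} → ¬ E x x
    connected   : ConnectedIn E Everything
    minimal     : ∀ u v → E u v →
                  ¬ Walk (λ x y → E x y × ¬ ((x ≡ u × y ≡ v) ⊎ (x ≡ v × y ≡ u)))
                         Everything u v

record Graph : Set where
  field
    n      : ℕ
    adj    : Fin n → Fin n → Bool
    sym    : ∀ x y → adj x y ≡ adj y x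
    irrefl : ∀ x → adj x x ≡ false

module _ (G : Graph) where
  open Graph G

  V : Set
  V = Fin n

  VSet : Set₁
  VSet = V → Set

  _~_ : V → V → Set
  x ~ y = T (adj x y)

  record TreeDecomposition (S : VSet) (w : ℕ) : Set₁ where
    field
      m       : ℕ
      tadj    : Fin (suc m) → Fin (suc m) → Set
      isTree  : IsTree tadj
      bag     : Fin (suc m) → List V
      bag⊆S   : ∀ t v → v ∈ bag t → S v
      vcover  : ∀ v → S v → ∃ λ t → v ∈ bag t
      ecover  : ∀ u v → S u → S v → u ~ v → ∃ λ t → (u ∈ bag t × v ∈ bag t)
      coherent : ∀ v → ConnectedIn tadj (λ t → v ∈ bag t)
      width   : ∀ t → length (bag t) ≤ suc w

  TW : VSet → ℕ → Set₁
  TW S t = TreeDecomposition S t × (∀ w → TreeDecomposition S w → t ≤ w)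

  record Component (S C : VSet) : Set where
    field
      nonempty  : ∃ λ v → C v
      outside   : ∀ v → C v → ¬ S v
      connected : ConnectedIn _~_ C
      closed    : ∀ u v → C u → ¬ S v → u ~ v → C v

  record ExactlyTwoComponents (S X Y : VSet) : Set where
    field
      compX    : Component S X
      compY    : Component S Y
      disjoint : ∀ v → X v → ¬ Y v
      cover    : ∀ v → ¬ S v → X v ⊎ Y v

  Clique : VSet → Set
  Clique K = ∀ u v → K u → K v → u ≢ v → u ~ v

  record IPath (a b : V) : Set where
    field
      len     : ℕ
      p       : Fin (suc len) → V
      inj     : ∀ i j → p i ≡ p j → i ≡ j
      start   : p zero ≡ a
      end     : p (fromℕ len) ≡ b
      induced : ∀ i j → (p i ~ p j → (suc (toℕ i) ≡ toℕ j ⊎ suc (toℕ j) ≡ toℕ i))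
                      × ((suc (toℕ i) ≡ toℕ j ⊎ suc (toℕ j) ≡ toℕ i) → p i ~ p j)

  open IPath public

  Internal : ∀ {a b} → (P : IPath a b) → Fin (suc (len P)) → Set
  Internal P i = 0 < toℕ i × toℕ i < len P

  InternalIn : ∀ {a b} → IPath a b → VSet → Set
  InternalIn P X = ∀ i → Internal P i → X (p P i)

  VP : ∀ {a b} → IPath a b → VSet
  VP P v = ∃ λ i → p P i ≡ v

  IsABPath : V → VSet → V → Set
  IsABPath a Z b = Σ (IPath a b) λ P →
    ∀ v → (VP P v → (Z v ⊎ v ≡ a ⊎ v ≡ b)) × ((Z v ⊎ v ≡ a ⊎ v ≡ b) → VP P v)

  AvoidsNbrs : ∀ {a b} → IPath a b → V → Set
  AvoidsNbrs P c = ∀ i → Internal P i → ¬ (c ~ p P i)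

  pair : VSet → VSet → Fin 2 → VSet
  pair A B zero = A
  pair A B (suc _) = B

  data Decomposition : (k : ℕ) → (Fin k → VSet) → Set₁ where
    cliqueSep :
      (K : VSet) → Clique K →
      (k : ℕ) → 2 ≤ k → (C : Fin k → VSet) →
      (∀ i → Component K (C i)) →
      (∀ i j → i ≢ j → ∀ v → C i v → ¬ C j v) →
      (∀ v → ¬ K v → ∃ λ i → C i v) →
      Decomposition k (λ i v → K v ⊎ C i v)
    twoSep :
      (a b : V) → a ≢ b → ¬ (a ~ b) →
      (X Y : VSet) →
      ExactlyTwoComponents (λ v → v ≡ a ⊎ v ≡ b) X Y →
      (∃ λ (P : IPath a b) → InternalIn P X) →
      (∃ λ (Q : IPath a b) → InternalIn Q Y) →
      ¬ IsABPath a X b → ¬ IsABPath a Y b →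
      (P : IPath a b) → InternalIn P X →
      (Q : IPath a b) → InternalIn Q Y →
      Decomposition 2 (pair (λ v → X v ⊎ v ≡ a ⊎ v ≡ b ⊎ VP Q v)
                            (λ v → VP P v ⊎ v ≡ a ⊎ v ≡ b ⊎ Y v))
    p3Sep :
      (a c b : V) → a ~ c → c ~ b → ¬ (a ~ b) → a ≢ b →
      (X Y : VSet) →
      ExactlyTwoComponents (λ v → v ≡ a ⊎ v ≡ c ⊎ v ≡ b) X Y →
      (∃ λ (P : IPath a b) → InternalIn P X) →
      (∃ λ (Q : IPath a b) → InternalIn Q Y) →
      (∃ λ x → X x × c ~ x) → (∃ λ y → Y y × c ~ y) →
      (∃ λ (P : IPath a b) → InternalIn P X × AvoidsNbrs P c) →
      (∀ (Q : IPath a b) → InternalIn Q Y → ∃ λ i → Internal Q i × c ~ p Q i) →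
      ¬ IsABPath a X b → ¬ IsABPath a Y b →
      (P : IPath a b) → InternalIn P X → AvoidsNbrs P c →
      (Q : IPath a b) → InternalIn Q Y →
      Decomposition 2 (pair (λ v → X v ⊎ v ≡ a ⊎ v ≡ c ⊎ v ≡ b ⊎ VP Q v)
                            (λ v → VP P v ⊎ v ≡ a ⊎ v ≡ c ⊎ v ≡ b ⊎ Y v))

maxF : (k : ℕ) → (Fin k → ℕ) → ℕ
maxF zero    f = 0
maxF (suc k) f = f zero ⊔ maxF k (λ i → f (suc i))

{-# OPTIONS --safe #-}
module Submission where

-- Each block is an induced subgraph of G, so restricting the bags of a decomposition of G to a
-- block gives the lower bound.  For the upper bound, decompositions of the blocks are glued
-- along bags containing the separator S; this is possible because no edge joins different
-- components of G ∖ S.  A clique separator lies in a bag of every decomposition, by the Helly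
-- property of subtrees of a tree.  For a proper 2- or P₃-separator with ends a, b, the block
-- G_X contains an ab-path Q through the other component: contracting the interior of Q onto a
-- turns a decomposition of G_X into one of G[S ∪ X], of no larger width, in which a and b share
-- a bag.  Then S is a clique up to the pair ab, so again it lies in a single bag.

open import Defs
open import Data.Bool using (Bool; true; false; T)
open import Data.Empty using (⊥; ⊥-elim)
open import Data.Fin using (Fin; zero; suc; toℕ; fromℕ; inject₁; splitAt; join; _≟_)
open import Data.Fin.Properties using (any?; all?; toℕ-inject₁; inject₁ℕ<; suc-injective; splitAt-join; join-splitAt)
open import Data.List using (List; length; filter; map; allFin; upTo)
open import Data.List.Extrema.Nat using (argmin; argmax; argmin-all; argmax-all; f[argmin]≤f[xs]; f[argmin]≤f[⊤]; f[xs]≤f[argmax])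
open import Data.List.Membership.Propositional using (_∈_)
open import Data.List.Membership.Propositional.Properties using (∈-filter⁺; ∈-filter⁻; ∈-map⁺; ∈-map⁻; ∈-allFin; ∈-upTo⁺)
open import Data.List.Properties using (length-filter; length-map)
open import Data.List.Relation.Unary.All as All using (All)
open import Data.List.Relation.Unary.All.Properties using (all-filter)
open import Data.Nat using (ℕ; zero; suc; _+_; _≤_; _<_; z≤n; s≤s)
open import Data.Nat.Properties using (≤-refl; ≤-trans; <⇒≤; ≤-<-trans; <-≤-trans; ≤-pred; <⇒≱; ≰⇒>; _≤?_; _<?_; ⊔-lub; m≤m⊔n; m≤n⊔m)
open import Data.Product using (Σ; ∃; _×_; _,_; proj₁; proj₂)
open import Data.Sum using (_⊎_; inj₁; inj₂; [_,_]′; map₂; swap)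
open import Data.Unit using (tt)
open import Function using (id; _∘_; const)
open import Relation.Binary.PropositionalEquality using (_≡_; _≢_; refl; sym; trans; cong; subst; subst₂)
open import Relation.Nullary using (¬_; Dec; yes; no)
open import Relation.Nullary.Decidable using (_×-dec_; _⊎-dec_; _→-dec_; ¬?; map′; decidable-stable; ¬¬-excluded-middle)
open import Relation.Unary using (Decidable; _⊆_; _∪_)

module _ {A : Set} {R : A → A → Set} {X : A → Set} where

  headʷ : ∀ {a b} → Walk R X a b → X a
  headʷ (here x)     = x
  headʷ (step x _ _) = x

  lastʷ : ∀ {a b} → Walk R X a b → X b
  lastʷ (here x)     = x
  lastʷ (step _ _ w) = lastʷ w

  infixr 5 _++ʷ_
  _++ʷ_ : ∀ {a b c} → Walk R X a b → Walk R X b c → Walk R X a c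
  here _     ++ʷ w′ = w′
  step x r w ++ʷ w′ = step x r (w ++ʷ w′)

  reverseʷ : (∀ {x y} → R x y → R y x) → ∀ {a b} → Walk R X a b → Walk R X b a
  reverseʷ R-sym (here x)     = here x
  reverseʷ R-sym (step x r w) = reverseʷ R-sym w ++ʷ step (headʷ w) (R-sym r) (here x)

  dropLoopsʷ : ∀ {a b} → Walk (λ x y → R x y ⊎ x ≡ y) X a b → Walk R X a b
  dropLoopsʷ (here x)               = here x
  dropLoopsʷ (step x (inj₁ r) w)    = step x r (dropLoopsʷ w)
  dropLoopsʷ (step x (inj₂ refl) w) = dropLoopsʷ w

  walk-invariant : ∀ {B : Set} (f : A → B) → (∀ {x y} → R x y → f x ≡ f y) →
                   ∀ {a b} → Walk R X a b → f a ≡ f b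
  walk-invariant f f-inv (here _)     = refl
  walk-invariant f f-inv (step _ r w) = trans (f-inv r) (walk-invariant f f-inv w)

mapʷ : ∀ {A B : Set} {R : A → A → Set} {X : A → Set} {R′ : B → B → Set} {X′ : B → Set}
       (f : A → B) → (∀ {x y} → R x y → R′ (f x) (f y)) → (∀ {x} → X x → X′ (f x)) →
       ∀ {a b} → Walk R X a b → Walk R′ X′ (f a) (f b)
mapʷ f f-R f-X (here x)     = here (f-X x)
mapʷ f f-R f-X (step x r w) = step (f-X x) (f-R r) (mapʷ f f-R f-X w)

weakenʷ : ∀ {A : Set} {R : A → A → Set} {X X′ : A → Set} →
          (∀ {x} → X x → X′ x) → ∀ {a b} → Walk R X a b → Walk R X′ a b
weakenʷ = mapʷ id id

Pair : {A : Set} → A → A → A → A → Set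
Pair a b u v = (u ≡ a × v ≡ b) ⊎ (u ≡ b × v ≡ a)

pair-sym : ∀ {A : Set} {a b u v : A} → Pair a b u v → Pair a b v u
pair-sym (inj₁ (u≡a , v≡b)) = inj₂ (v≡b , u≡a)
pair-sym (inj₂ (u≡b , v≡a)) = inj₁ (v≡a , u≡b)

pair-map : ∀ {A B : Set} (f : A → B) {a b u v} → Pair a b u v → Pair (f a) (f b) (f u) (f v)
pair-map f (inj₁ (refl , refl)) = inj₁ (refl , refl)
pair-map f (inj₂ (refl , refl)) = inj₂ (refl , refl)

pair-reflect : ∀ {A B : Set} {f : A → B} → (∀ {x y} → f x ≡ f y → x ≡ y) →
               ∀ {a b u v} → Pair (f a) (f b) (f u) (f v) → Pair a b u v
pair-reflect f-injective (inj₁ (p , q)) = inj₁ (f-injective p , f-injective q)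
pair-reflect f-injective (inj₂ (p , q)) = inj₂ (f-injective p , f-injective q)

Without : {A : Set} → (A → A → Set) → A → A → A → A → Set
Without R u v x y = R x y × ¬ Pair u v x y

without-swap : ∀ {A : Set} {R : A → A → Set} {u v x y} → Without R u v x y → Without R v u x y
without-swap (r , ¬uv) = r , ¬uv ∘ swap

without-sym : ∀ {A : Set} {R : A → A → Set} → (∀ {x y} → R x y → R y x) →
              ∀ {u v x y} → Without R u v x y → Without R u v y x
without-sym R-sym (r , ¬uv) = R-sym r , ¬uv ∘ pair-sym

walk-along : ∀ {A : Set} {R : A → A → Set} {l} (f : Fin (suc l) → A) →
             (∀ i → R (f (inject₁ i)) (f (suc i))) →
             ∀ i → Walk R (λ x → ∃ λ j → toℕ j ≤ toℕ i × f j ≡ x) (f zero) (f i)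
walk-along f adj zero = here (zero , z≤n , refl)
walk-along {l = suc l} f adj (suc i) =
  step (zero , z≤n , refl) (adj zero) (weakenʷ shift (walk-along (f ∘ suc) (adj ∘ suc) i))
  where
    shift : ∀ {x} → (∃ λ j → toℕ j ≤ toℕ i × f (suc j) ≡ x) → ∃ λ j → toℕ j ≤ suc (toℕ i) × f j ≡ x
    shift (j , j≤i , eq) = suc j , s≤s j≤i , eq

module _ {A : Set} (f : A → ℕ) {Q : A → Set} (Q? : Decidable Q) (xs : List A) where

  minimiser : ∀ {x} → Q x → Σ A λ y → Q y × f y ≤ f x × (∀ {z} → z ∈ xs → Q z → f y ≤ f z)
  minimiser {x} qx = argmin f x (filter Q? xs) , argmin-all f qx (all-filter Q? xs) ,
                     f[argmin]≤f[⊤] {f = f} x (filter Q? xs) ,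
                     λ z∈xs qz → All.lookup (f[argmin]≤f[xs] x (filter Q? xs)) (∈-filter⁺ Q? z∈xs qz)

  maximiser : ∀ {x} → Q x → Σ A λ y → Q y × (∀ {z} → z ∈ xs → Q z → f z ≤ f y)
  maximiser {x} qx = argmax f x (filter Q? xs) , argmax-all f qx (all-filter Q? xs) ,
                     λ z∈xs qz → All.lookup (f[xs]≤f[argmax] x (filter Q? xs)) (∈-filter⁺ Q? z∈xs qz)

least : ∀ {P : ℕ → Set} → Decidable P → ∀ {N} → P N → Σ ℕ λ L → P L × (∀ {L′} → P L′ → L ≤ L′)
least {P} P? {N} pN with minimiser id P? (upTo N) pN
... | L , pL , L≤N , L-min = L , pL , below-or-above
  where
    below-or-above : ∀ {L′} → P L′ → L ≤ L′
    below-or-above {L′} pL′ with suc L′ ≤? N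
    ... | yes L′<N = L-min (∈-upTo⁺ L′<N) pL′
    ... | no L′≮N  = ≤-trans L≤N (≤-pred (≰⇒> L′≮N))

module _ {N : ℕ} (f : Fin N → ℕ) {Q : Fin N → Set} (Q? : Decidable Q) where

  argmin-Fin : ∃ Q → Σ (Fin N) λ t → Q t × (∀ s → Q s → f t ≤ f s)
  argmin-Fin (_ , qx) with minimiser f Q? (allFin N) qx
  ... | t , qt , _ , t-min = t , qt , λ s → t-min (∈-allFin s)

  argmax-Fin : ∃ Q → Σ (Fin N) λ t → Q t × (∀ s → Q s → f s ≤ f t)
  argmax-Fin (_ , qx) with maximiser f Q? (allFin N) qx
  ... | t , qt , t-max = t , qt , λ s → t-max (∈-allFin s)

¬¬-Π-Fin : ∀ {N} {P : Fin N → Set} → (∀ i → ¬ ¬ P i) → ¬ ¬ (∀ i → P i)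
¬¬-Π-Fin {zero}  _    ¬all = ¬all λ ()
¬¬-Π-Fin {suc N} ¬¬P ¬all = ¬¬P zero λ p₀ → ¬¬-Π-Fin (¬¬P ∘ suc) λ ps → ¬all λ { zero → p₀ ; (suc i) → ps i }

shared-part? : ∀ {A : Set} {K C₀ C₁ : A → Set} → (∀ {v} → C₀ v → ¬ C₁ v) →
               Decidable (K ∪ C₀) → Decidable (K ∪ C₁) → Decidable K
shared-part? disjoint K∪C₀? K∪C₁? v with K∪C₀? v | K∪C₁? v
... | no ¬b₀        | _             = no (¬b₀ ∘ inj₁)
... | yes _         | no ¬b₁        = no (¬b₁ ∘ inj₁)
... | yes (inj₁ k)  | yes _         = yes k
... | yes (inj₂ _)  | yes (inj₁ k)  = yes k
... | yes (inj₂ c₀) | yes (inj₂ c₁) = ⊥-elim (disjoint c₀ c₁)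

-- Rooted trees and the Helly property

module RootedTree {m : ℕ} {E : Fin (suc m) → Fin (suc m) → Set}
                  (tree : IsTree E) (E? : ∀ x y → Dec (E x y)) where
  open IsTree tree

  Node : Set
  Node = Fin (suc m)

  root : Node
  root = zero

  Reaches : ℕ → Node → Set
  Reaches zero    t = t ≡ root
  Reaches (suc L) t = t ≡ root ⊎ ∃ λ s → E t s × Reaches L s

  reaches? : ∀ L → Decidable (Reaches L)
  reaches? zero    t = t ≟ root
  reaches? (suc L) t = (t ≟ root) ⊎-dec any? (λ s → E? t s ×-dec reaches? L s)

  walk⇒reaches : ∀ {X t} → Walk E X t root → ∃ λ L → Reaches L t
  walk⇒reaches (here _)     = zero , refl
  walk⇒reaches (step _ e w) with walk⇒reaches w
  ... | L , reaches = suc L , inj₂ (_ , e , reaches)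

  private
    shortest : ∀ t → Σ ℕ λ L → Reaches L t × (∀ {L′} → Reaches L′ t → L ≤ L′)
    shortest t = least (λ L → reaches? L t) (proj₂ (walk⇒reaches (connected t root tt tt)))

  depth : Node → ℕ
  depth t = proj₁ (shortest t)

  depth-reaches : ∀ t → Reaches (depth t) t
  depth-reaches t = proj₁ (proj₂ (shortest t))

  depth-minimal : ∀ {L t} → Reaches L t → depth t ≤ L
  depth-minimal {t = t} = proj₂ (proj₂ (shortest t))

  closer-neighbour : ∀ t → t ≢ root → Σ Node λ s → E t s × depth s < depth t
  closer-neighbour t t≢root with depth t | depth-reaches t
  ... | zero  | t≡root                 = ⊥-elim (t≢root t≡root)
  ... | suc L | inj₁ t≡root            = ⊥-elim (t≢root t≡root)
  ... | suc L | inj₂ (s , e , reaches) = s , e , s≤s (depth-minimal reaches)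

  -- junk value: the root is its own parent
  parent : Node → Node
  parent t with t ≟ root
  ... | yes _       = root
  ... | no t≢root   = proj₁ (closer-neighbour t t≢root)

  parent-spec : ∀ t → t ≢ root → E t (parent t) × depth (parent t) < depth t
  parent-spec t t≢root with t ≟ root
  ... | yes t≡root  = ⊥-elim (t≢root t≡root)
  ... | no t≢root′  = proj₂ (closer-neighbour t t≢root′)

  parent-induction : (P : Node → Set) → P root → (∀ t → t ≢ root → P (parent t) → P t) → ∀ t → P t
  parent-induction P P-root P-step t = go (suc (depth t)) t ≤-refl
    where
      go : ∀ N t → depth t < N → P t
      go (suc N) t d<N with t ≟ root
      ... | yes refl    = P-root
      ... | no t≢root   =
        P-step t t≢root (go N (parent t) (<-≤-trans (proj₂ (parent-spec t t≢root)) (≤-pred d<N)))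

  ParentEdge : Node → Node → Set
  ParentEdge s t = s ≢ root × parent s ≡ t

  parentEdge? : ∀ s t → Dec (ParentEdge s t)
  parentEdge? s t = ¬? (s ≟ root) ×-dec (parent s ≟ t)

  parentEdge⇒edge : ∀ {s t} → ParentEdge s t → E s t
  parentEdge⇒edge {s} (s≢root , refl) = proj₁ (parent-spec s s≢root)

  -- Below z x : z is an ancestor of x (or x itself)
  Below : Node → Node → Set
  Below z x = Walk ParentEdge Everything x z

  below-root : ∀ x → Below root x
  below-root = parent-induction (Below root) (here tt) (λ t t≢root → step tt (t≢root , refl))

  below? : ∀ z x → Dec (Below z x)
  below? z = parent-induction (Dec ∘ Below z) at-root upward
    where
      at-root : Dec (Below z root)
      at-root with root ≟ z
      ... | yes refl    = yes (here tt)
      ... | no root≢z   = no λ { (here _) → root≢z refl ; (step _ (root≢root , _) _) → root≢root refl }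

      upward : ∀ t → t ≢ root → Dec (Below z (parent t)) → Dec (Below z t)
      upward t t≢root below-parent with t ≟ z
      ... | yes refl  = yes (here tt)
      ... | no t≢z    = map′ (step tt (t≢root , refl)) from-parent below-parent
        where
          from-parent : Below z t → Below z (parent t)
          from-parent (here _)              = ⊥-elim (t≢z refl)
          from-parent (step _ (_ , refl) b) = b

  below-depth : ∀ {z x} → Below z x → depth z ≤ depth x
  below-depth (here _)                  = ≤-refl
  below-depth (step _ (x≢root , refl) b) = <⇒≤ (≤-<-trans (below-depth b) (proj₂ (parent-spec _ x≢root)))

  strictly-below-depth : ∀ {z x} → Below z x → x ≢ z → depth z < depth x
  strictly-below-depth (here _)                   x≢z = ⊥-elim (x≢z refl)
  strictly-below-depth (step _ (x≢root , refl) b) _   = ≤-<-trans (below-depth b) (proj₂ (parent-spec _ x≢root))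

  -- otherwise the two ways up to the root would close a cycle through the edge
  edge⇒parentEdge : ∀ {x y} → E x y → ParentEdge x y ⊎ ParentEdge y x
  edge⇒parentEdge {x} {y} e with parentEdge? x y ⊎-dec parentEdge? y x
  ... | yes pe = pe
  ... | no ¬pe = ⊥-elim (minimal x y e (avoiding (below-root x) ++ʷ reverseʷ (without-sym E-sym) (avoiding (below-root y))))
    where
      avoiding : ∀ {s t} → Walk ParentEdge Everything s t → Walk (Without E x y) Everything s t
      avoiding = mapʷ id (λ pe → parentEdge⇒edge pe , λ { (inj₁ (refl , refl)) → ¬pe (inj₁ pe)
                                                        ; (inj₂ (refl , refl)) → ¬pe (inj₂ pe) }) id

  leave-below : ∀ {A : Node → Set} {z x y} → Walk E A x y → Below z x → ¬ Below z y →
                z ≢ root × A z × A (parent z)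
  leave-below (here _) bx ¬by = ⊥-elim (¬by bx)
  leave-below {z = z} (step {b = x′} ax e w) bx ¬by with below? z x′
  ... | yes bx′ = leave-below w bx′ ¬by
  ... | no ¬bx′ with edge⇒parentEdge e | bx
  ...   | inj₂ pe             | _                    = ⊥-elim (¬bx′ (step tt pe bx))
  ...   | inj₁ (x≢root , refl) | here _               = x≢root , ax , headʷ w
  ...   | inj₁ (_ , refl)      | step _ (_ , refl) bp = ⊥-elim (¬bx′ bp)

  module _ {n : ℕ} (M : Fin n → Node → Set) (M? : ∀ v t → Dec (M v t))
           (M-connected : ∀ v → ConnectedIn E (M v)) where

    top : Fin n → Node
    top v with any? (M? v)
    ... | yes nonempty = proj₁ (argmin-Fin depth (M? v) nonempty)
    ... | no _         = root

    top-spec : ∀ v → ∃ (M v) → M v (top v) × (∀ s → M v s → depth (top v) ≤ depth s)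
    top-spec v nonempty′ with any? (M? v)
    ... | yes nonempty = proj₂ (argmin-Fin depth (M? v) nonempty)
    ... | no empty     = ⊥-elim (empty nonempty′)

    below-top : ∀ {v x} → M v x → Below (top v) x
    below-top {v} {x} mx with top-spec v (x , mx) | below? (top v) x
    ... | _ , _         | yes b = b
    ... | m-top , t-min | no ¬b with leave-below (M-connected v (top v) x m-top mx) (here tt) ¬b
    ...   | top≢root , _ , m-parent =
      ⊥-elim (<⇒≱ (proj₂ (parent-spec (top v) top≢root)) (t-min (parent (top v)) m-parent))

    top-meets : ∀ {u v x} → M u x → M v x → depth (top u) ≤ depth (top v) → M u (top v)
    top-meets {u} {v} {x} mux mvx u-shallower with below? (top v) (top u)
    ... | no ¬b = proj₁ (proj₂ (leave-below (M-connected u x (top u) mux (proj₁ (top-spec u (x , mux))))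
                                            (below-top mvx) ¬b))
    ... | yes b with top u ≟ top v
    ...   | yes same  = subst (M u) same (proj₁ (top-spec u (x , mux)))
    ...   | no differ = ⊥-elim (<⇒≱ (strictly-below-depth b differ) u-shallower)

    -- the top of the subtree whose top is deepest lies in every subtree
    helly : {K : Fin n → Set} → Decidable K → (∀ {u v} → K u → K v → ∃ λ t → M u t × M v t) →
            ∃ λ t → ∀ {v} → K v → M v t
    helly {K} K? pairwise with any? K?
    ... | no K-empty  = root , λ {v} kv → ⊥-elim (K-empty (v , kv))
    ... | yes K-inhabited =
      let v* , kv* , deepest = argmax-Fin (depth ∘ top) K? K-inhabited in
      top v* , λ {u} ku → let _ , mux , mv*x = pairwise ku kv* in top-meets mux mv*x (deepest u ku)

-- Gluing two trees at a node

module TreeSum {m₁ m₂ : ℕ} {E₁ : Fin (suc m₁) → Fin (suc m₁) → Set} {E₂ : Fin (suc m₂) → Fin (suc m₂) → Set}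
               (tree₁ : IsTree E₁) (tree₂ : IsTree E₂) (t₁ : Fin (suc m₁)) (t₂ : Fin (suc m₂)) where

  Node : Set
  Node = Fin (suc m₁) ⊎ Fin (suc m₂)

  Edge : Node → Node → Set
  Edge (inj₁ x) (inj₁ y) = E₁ x y
  Edge (inj₂ x) (inj₂ y) = E₂ x y
  Edge (inj₁ x) (inj₂ y) = x ≡ t₁ × y ≡ t₂
  Edge (inj₂ x) (inj₁ y) = y ≡ t₁ × x ≡ t₂

  edge-sym : ∀ {s t} → Edge s t → Edge t s
  edge-sym {inj₁ _} {inj₁ _} e = IsTree.E-sym tree₁ e
  edge-sym {inj₂ _} {inj₂ _} e = IsTree.E-sym tree₂ e
  edge-sym {inj₁ _} {inj₂ _} e = e
  edge-sym {inj₂ _} {inj₁ _} e = e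

  edge-irrefl : ∀ {s} → ¬ Edge s s
  edge-irrefl {inj₁ _} = IsTree.E-irrefl tree₁
  edge-irrefl {inj₂ _} = IsTree.E-irrefl tree₂

  connected-sum : ∀ {P : Node → Set} → ConnectedIn E₁ (P ∘ inj₁) → ConnectedIn E₂ (P ∘ inj₂) →
                  (∀ {x y} → P (inj₁ x) → P (inj₂ y) → P (inj₁ t₁) × P (inj₂ t₂)) → ConnectedIn Edge P
  connected-sum c₁ c₂ meet (inj₁ x) (inj₁ y) px py = mapʷ {R′ = Edge} inj₁ id id (c₁ x y px py)
  connected-sum c₁ c₂ meet (inj₂ x) (inj₂ y) px py = mapʷ {R′ = Edge} inj₂ id id (c₂ x y px py)
  connected-sum c₁ c₂ meet (inj₁ x) (inj₂ y) px py with meet px py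
  ... | p₁ , p₂ = mapʷ inj₁ id id (c₁ x t₁ px p₁) ++ʷ step p₁ (refl , refl) (mapʷ inj₂ id id (c₂ t₂ y p₂ py))
  connected-sum c₁ c₂ meet (inj₂ x) (inj₁ y) px py with meet py px
  ... | p₁ , p₂ = mapʷ inj₂ id id (c₂ x t₂ px p₂) ++ʷ step p₂ (refl , refl) (mapʷ inj₁ id id (c₁ t₁ y p₁ py))

  side : Node → Bool
  side = [ const true , const false ]′

  bridge-avoiding : ∀ {s t} → Without Edge (inj₁ t₁) (inj₂ t₂) s t → side s ≡ side t
  bridge-avoiding {inj₁ _} {inj₁ _} _                 = refl
  bridge-avoiding {inj₂ _} {inj₂ _} _                 = refl
  bridge-avoiding {inj₁ _} {inj₂ _} ((refl , refl) , ¬bridge) = ⊥-elim (¬bridge (inj₁ (refl , refl)))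
  bridge-avoiding {inj₂ _} {inj₁ _} ((refl , refl) , ¬bridge) = ⊥-elim (¬bridge (inj₂ (refl , refl)))

  -- collapsing the second tree onto t₁ turns a walk in the sum into a walk in the first tree
  π₁ : Node → Fin (suc m₁)
  π₁ = [ id , const t₁ ]′

  π₂ : Node → Fin (suc m₂)
  π₂ = [ const t₂ , id ]′

  project₁ : ∀ {x y s t} → Without Edge (inj₁ x) (inj₁ y) s t → Without E₁ x y (π₁ s) (π₁ t) ⊎ π₁ s ≡ π₁ t
  project₁ {s = inj₁ _} {inj₁ _} (e , ¬xy) = inj₁ (e , ¬xy ∘ pair-map inj₁)
  project₁ {s = inj₁ _} {inj₂ _} ((p , _) , _) = inj₂ p
  project₁ {s = inj₂ _} {inj₁ _} ((p , _) , _) = inj₂ (sym p)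
  project₁ {s = inj₂ _} {inj₂ _} _             = inj₂ refl

  project₂ : ∀ {x y s t} → Without Edge (inj₂ x) (inj₂ y) s t → Without E₂ x y (π₂ s) (π₂ t) ⊎ π₂ s ≡ π₂ t
  project₂ {s = inj₂ _} {inj₂ _} (e , ¬xy) = inj₁ (e , ¬xy ∘ pair-map inj₂)
  project₂ {s = inj₂ _} {inj₁ _} ((_ , p) , _) = inj₂ p
  project₂ {s = inj₁ _} {inj₂ _} ((_ , p) , _) = inj₂ (sym p)
  project₂ {s = inj₁ _} {inj₁ _} _             = inj₂ refl

  edge-minimal : ∀ u v → Edge u v → ¬ Walk (Without Edge u v) Everything u v
  edge-minimal (inj₁ x) (inj₁ y) e w =
    IsTree.minimal tree₁ x y e (dropLoopsʷ (mapʷ {R = Without Edge (inj₁ x) (inj₁ y)} π₁ project₁ id w))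
  edge-minimal (inj₂ x) (inj₂ y) e w =
    IsTree.minimal tree₂ x y e (dropLoopsʷ (mapʷ {R = Without Edge (inj₂ x) (inj₂ y)} π₂ project₂ id w))
  edge-minimal (inj₁ x) (inj₂ y) (refl , refl) w with walk-invariant side bridge-avoiding w
  ... | ()
  edge-minimal (inj₂ x) (inj₁ y) (refl , refl) w
    with walk-invariant side (λ r → bridge-avoiding (without-swap {R = Edge} r)) w
  ... | ()

  φ : Fin (suc m₁ + suc m₂) → Node
  φ = splitAt (suc m₁)

  ψ : Node → Fin (suc m₁ + suc m₂)
  ψ = join (suc m₁) (suc m₂)

  φ∘ψ : ∀ s → φ (ψ s) ≡ s
  φ∘ψ = splitAt-join (suc m₁) (suc m₂)

  ψ∘φ : ∀ x → ψ (φ x) ≡ x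
  ψ∘φ = join-splitAt (suc m₁) (suc m₂)

  Edgeᶠ : Fin (suc m₁ + suc m₂) → Fin (suc m₁ + suc m₂) → Set
  Edgeᶠ x y = Edge (φ x) (φ y)

  connectedᶠ : ∀ {P} → ConnectedIn Edge P → ConnectedIn Edgeᶠ (P ∘ φ)
  connectedᶠ {P} c x y px py =
    subst₂ (Walk Edgeᶠ (P ∘ φ)) (ψ∘φ x) (ψ∘φ y)
      (mapʷ ψ (λ {s} {t} e → subst₂ Edge (sym (φ∘ψ s)) (sym (φ∘ψ t)) e)
              (λ {s} ps → subst P (sym (φ∘ψ s)) ps)
              (c (φ x) (φ y) px py))

  φ-injective : ∀ {x y} → φ x ≡ φ y → x ≡ y
  φ-injective {x} {y} eq = trans (sym (ψ∘φ x)) (trans (cong ψ eq) (ψ∘φ y))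

  connected-everywhere : ConnectedIn Edge Everything
  connected-everywhere = connected-sum (IsTree.connected tree₁) (IsTree.connected tree₂) (λ _ _ → tt , tt)

  without-φ : ∀ {u v x y} → Without Edgeᶠ u v x y → Without Edge (φ u) (φ v) (φ x) (φ y)
  without-φ (e , ¬uv) = e , ¬uv ∘ pair-reflect φ-injective

  isTreeᶠ : IsTree Edgeᶠ
  isTreeᶠ = record
    { E-sym     = λ {x} {y} → edge-sym {φ x} {φ y}
    ; E-irrefl  = λ {x} → edge-irrefl {φ x}
    ; connected = connectedᶠ connected-everywhere
    ; minimal   = λ u v e w → edge-minimal (φ u) (φ v) e (mapʷ {R = Without Edgeᶠ u v} φ without-φ id w)
    }

module _ (G : Graph) where
  open TreeDecomposition
  open Component
  open ExactlyTwoComponents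
  open import Data.List.Membership.DecPropositional (_≟_ {Graph.n G}) using (_∈?_)

  private
    _∼_ : V G → V G → Set
    _∼_ = _~_ G

    TD : VSet G → ℕ → Set₁
    TD = TreeDecomposition G

  ∼-sym : ∀ {x y} → x ∼ y → y ∼ x
  ∼-sym {x} {y} = subst T (Graph.sym G x y)

  BagContaining : ∀ {S w} → TD S w → VSet G → Set
  BagContaining T K = ∃ λ t → ∀ {v} → K v → v ∈ bag T t

  td-dec : ∀ {S w} → TD S w → Decidable S
  td-dec T v with any? (λ t → v ∈? bag T t)
  ... | yes (t , v∈t) = yes (bag⊆S T t v v∈t)
  ... | no  v∉T       = no λ sv → v∉T (vcover T v sv)

  td-widen : ∀ {S w w′} → TD S w → w ≤ w′ → TD S w′
  td-widen T w≤w′ = record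
    { TreeDecomposition T hiding (width)
    ; width = λ t → ≤-trans (width T t) (s≤s w≤w′)
    }

  td-cong : ∀ {S S′ w} → TD S w → S ⊆ S′ → S′ ⊆ S → TD S′ w
  td-cong T S⊆S′ S′⊆S = record
    { TreeDecomposition T hiding (bag⊆S; vcover; ecover)
    ; bag⊆S  = λ t v v∈t → S⊆S′ (bag⊆S T t v v∈t)
    ; vcover = λ v sv → vcover T v (S′⊆S sv)
    ; ecover = λ u v su sv → ecover T u v (S′⊆S su) (S′⊆S sv)
    }

  td-restrict : ∀ {S S′ w} → TD S w → Decidable S′ → S′ ⊆ S → TD S′ w
  td-restrict {S′ = S′} T S′? S′⊆S = record
    { TreeDecomposition T using (m; tadj; isTree)
    ; bag      = bag′
    ; bag⊆S    = λ t v v∈t → proj₂ (∈-filter⁻ S′? {xs = bag T t} v∈t)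
    ; vcover   = λ v sv → let t , v∈t = vcover T v (S′⊆S sv) in t , ∈-filter⁺ S′? v∈t sv
    ; ecover   = λ u v su sv e → let t , u∈t , v∈t = ecover T u v (S′⊆S su) (S′⊆S sv) e in
                                 t , ∈-filter⁺ S′? u∈t su , ∈-filter⁺ S′? v∈t sv
    ; coherent = λ v t t′ v∈t v∈t′ →
        let sv = proj₂ (∈-filter⁻ S′? {xs = bag T t} v∈t) in
        weakenʷ (λ v∈s → ∈-filter⁺ S′? v∈s sv)
                (coherent T v t t′ (proj₁ (∈-filter⁻ S′? {xs = bag T t} v∈t)) (proj₁ (∈-filter⁻ S′? {xs = bag T t′} v∈t′)))
    ; width    = λ t → ≤-trans (length-filter S′? (bag T t)) (width T t)
    }
    where
      bag′ : Fin (suc (m T)) → List (V G)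
      bag′ t = filter S′? (bag T t)

  -- The tree adjacency need not be decidable: it is only needed under a double negation,
  -- which the decidable conclusion discharges.
  td-helly : ∀ {S w K} (T : TD S w) → Decidable K →
             (∀ {u v} → K u → K v → ∃ λ t → u ∈ bag T t × v ∈ bag T t) → BagContaining T K
  td-helly {K = K} T K? pairwise = decidable-stable common-bag? λ ¬common →
    ¬¬-Π-Fin (λ x → ¬¬-Π-Fin λ y → ¬¬-excluded-middle) λ tadj? →
      ¬common (RootedTree.helly (isTree T) tadj? (λ v t → v ∈ bag T t) (λ v t → v ∈? bag T t) (coherent T) K? pairwise)
    where
      common-bag? : Dec (BagContaining T K)
      common-bag? = map′ (λ { (t , h) → t , λ {v} → h v }) (λ { (t , h) → t , λ v → h })
                         (any? λ t → all? λ v → K? v →-dec (v ∈? bag T t))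

  td-clique-bag : ∀ {S w K} {F : V G → V G → Set} (T : TD S w) → Decidable K → K ⊆ S →
                  (∀ {u v} → F u v → ∃ λ t → u ∈ bag T t × v ∈ bag T t) →
                  (∀ {u v} → K u → K v → u ≢ v → u ∼ v ⊎ F u v) → BagContaining T K
  td-clique-bag {K = K} T K? K⊆S F-covered clique = td-helly T K? pair-in-bag
    where
      pair-in-bag : ∀ {u v} → K u → K v → ∃ λ t → u ∈ bag T t × v ∈ bag T t
      pair-in-bag {u} {v} ku kv with u ≟ v
      ... | yes refl = let t , u∈t = vcover T u (K⊆S ku) in t , u∈t , u∈t
      ... | no  u≢v with clique ku kv u≢v
      ...   | inj₁ e   = ecover T u v (K⊆S ku) (K⊆S kv) e
      ...   | inj₂ fuv = F-covered fuv

  module _ {S₁ S₂ w} (T₁ : TD S₁ w) (T₂ : TD S₂ w) (t₁ : Fin (suc (m T₁))) (t₂ : Fin (suc (m T₂)))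
           (shared : ∀ {v} → S₁ v → S₂ v → v ∈ bag T₁ t₁ × v ∈ bag T₂ t₂)
           (no-crossing : ∀ {u v} → S₁ u → S₂ v → u ∼ v → S₂ u ⊎ S₁ v) where
    open TreeSum (isTree T₁) (isTree T₂) t₁ t₂

    private
      bagˢ : Node → List (V G)
      bagˢ = [ bag T₁ , bag T₂ ]′

      relabel : ∀ {v} s → v ∈ bagˢ s → v ∈ bagˢ (φ (ψ s))
      relabel {v} s v∈s = subst (λ s′ → v ∈ bagˢ s′) (sym (φ∘ψ s)) v∈s

      in-sides : ∀ s v → v ∈ bagˢ s → (S₁ ∪ S₂) v
      in-sides (inj₁ t) v v∈t = inj₁ (bag⊆S T₁ t v v∈t)
      in-sides (inj₂ t) v v∈t = inj₂ (bag⊆S T₂ t v v∈t)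

      vertex-bag : ∀ {v} → (S₁ ∪ S₂) v → ∃ λ s → v ∈ bagˢ s
      vertex-bag {v} (inj₁ sv) = let t , v∈t = vcover T₁ v sv in inj₁ t , v∈t
      vertex-bag {v} (inj₂ sv) = let t , v∈t = vcover T₂ v sv in inj₂ t , v∈t

      narrow : ∀ s → length (bagˢ s) ≤ suc w
      narrow (inj₁ t) = width T₁ t
      narrow (inj₂ t) = width T₂ t

      edge-bag : ∀ {u v} → (S₁ ∪ S₂) u → (S₁ ∪ S₂) v → u ∼ v → ∃ λ s → u ∈ bagˢ s × v ∈ bagˢ s
      edge-bag (inj₁ su) (inj₁ sv) e = let t , ut , vt = ecover T₁ _ _ su sv e in inj₁ t , ut , vt
      edge-bag (inj₂ su) (inj₂ sv) e = let t , ut , vt = ecover T₂ _ _ su sv e in inj₂ t , ut , vt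
      edge-bag (inj₁ su) (inj₂ sv) e with no-crossing su sv e
      ... | inj₁ su′ = let t , ut , vt = ecover T₂ _ _ su′ sv e in inj₂ t , ut , vt
      ... | inj₂ sv′ = let t , ut , vt = ecover T₁ _ _ su sv′ e in inj₁ t , ut , vt
      edge-bag (inj₂ su) (inj₁ sv) e with no-crossing sv su (∼-sym e)
      ... | inj₁ sv′ = let t , ut , vt = ecover T₂ _ _ su sv′ e in inj₂ t , ut , vt
      ... | inj₂ su′ = let t , ut , vt = ecover T₁ _ _ su′ sv e in inj₁ t , ut , vt

    td-glue : Σ (TD (S₁ ∪ S₂) w) λ T → ∃ λ t → bag T t ≡ bag T₁ t₁
    td-glue = glued , ψ (inj₁ t₁) , cong bagˢ (φ∘ψ (inj₁ t₁))
      where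
        glued : TD (S₁ ∪ S₂) w
        glued = record
          { m        = m T₁ + suc (m T₂)
          ; tadj     = Edgeᶠ
          ; isTree   = isTreeᶠ
          ; bag      = bagˢ ∘ φ
          ; bag⊆S    = in-sides ∘ φ
          ; vcover   = λ v sv → let s , v∈s = vertex-bag sv in ψ s , relabel s v∈s
          ; ecover   = λ u v su sv e → let s , u∈s , v∈s = edge-bag su sv e in ψ s , relabel s u∈s , relabel s v∈s
          ; coherent = λ v → connectedᶠ (connected-sum {λ s → v ∈ bagˢ s} (coherent T₁ v) (coherent T₂ v)
                               λ {x} {y} v∈x v∈y → shared (bag⊆S T₁ x v v∈x) (bag⊆S T₂ y v v∈y))
          ; width    = narrow ∘ φ
          }

  MeetsBag : ∀ {S w} (T : TD S w) → VSet G → Fin (suc (m T)) → Set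
  MeetsBag T J t = ∃ λ x → J x × x ∈ bag T t

  meetsBag-connected : ∀ {S w J a} (T : TD S w) → J ⊆ S → (∀ {x} → J x → Walk _∼_ J x a) →
                       ConnectedIn (tadj T) (MeetsBag T J)
  meetsBag-connected {J = J} {a} T J⊆S to-a t t′ (x , jx , x∈t) (x′ , jx′ , x′∈t′) =
    let s , a∈s , t⇝s = toward-a (to-a jx) x∈t
        s′ , a∈s′ , t′⇝s′ = toward-a (to-a jx′) x′∈t′
        ja = lastʷ (to-a jx)
    in t⇝s ++ʷ weakenʷ (λ a∈ → a , ja , a∈) (coherent T a s s′ a∈s a∈s′)
           ++ʷ reverseʷ (IsTree.E-sym (isTree T)) t′⇝s′
    where
      toward-a : ∀ {x t} → Walk _∼_ J x a → x ∈ bag T t →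
                 ∃ λ t′ → a ∈ bag T t′ × Walk (tadj T) (MeetsBag T J) t t′
      toward-a {t = t} (here ja) a∈t = t , a∈t , here (a , ja , a∈t)
      toward-a {x} {t} (step jx e w) x∈t =
        let s , x∈s , y∈s = ecover T _ _ (J⊆S jx) (J⊆S (headʷ w)) e
            t′ , a∈t′ , s⇝t′ = toward-a w y∈s
        in t′ , a∈t′ , weakenʷ (λ x∈ → x , jx , x∈) (coherent T x t s x∈t x∈s) ++ʷ s⇝t′

  -- Replacing every vertex of the connected set I by a in all bags contracts I onto a.
  module _ {S S′ I : VSet G} {w a} (T : TD S w) (I? : Decidable I) (S′? : Decidable S′)
           (S′⊆S : S′ ⊆ S) (I⊆S : I ⊆ S) (S′∩I=∅ : ∀ {v} → S′ v → ¬ I v) (S′a : S′ a)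
           (to-a : ∀ {x} → I x → Walk _∼_ (I ∪ (_≡ a)) x a) where

    private
      J : VSet G
      J = I ∪ (_≡ a)

      collapse : V G → V G
      collapse x with I? x
      ... | yes _ = a
      ... | no _  = x

      collapse-spec : ∀ x → (I x × collapse x ≡ a) ⊎ (¬ I x × collapse x ≡ x)
      collapse-spec x with I? x
      ... | yes ix = inj₁ (ix , refl)
      ... | no ¬ix = inj₂ (¬ix , refl)

      bag′ : Fin (suc (m T)) → List (V G)
      bag′ t = filter S′? (map collapse (bag T t))

      collapsed : ∀ {t x y} → x ∈ bag T t → collapse x ≡ y → S′ y → y ∈ bag′ t
      collapsed {t} x∈t refl s′y = ∈-filter⁺ S′? (∈-map⁺ collapse x∈t) s′y

      kept : ∀ {t y} → y ∈ bag T t → S′ y → y ∈ bag′ t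
      kept {y = y} y∈t s′y with collapse-spec y
      ... | inj₁ (iy , _) = ⊥-elim (S′∩I=∅ s′y iy)
      ... | inj₂ (_ , eq) = collapsed y∈t eq s′y

      merged : ∀ {t} → MeetsBag T J t → a ∈ bag′ t
      merged (x , inj₂ refl , x∈t) = kept x∈t S′a
      merged (x , inj₁ ix , x∈t) with collapse-spec x
      ... | inj₁ (_ , eq)  = collapsed x∈t eq S′a
      ... | inj₂ (¬ix , _) = ⊥-elim (¬ix ix)

      origin : ∀ {t y} → y ∈ bag′ t → S′ y × ∃ λ x → x ∈ bag T t × y ≡ collapse x
      origin {t} y∈t = let y∈map , s′y = ∈-filter⁻ S′? {xs = map collapse (bag T t)} y∈t in
                       s′y , ∈-map⁻ collapse y∈map

      unmerged : ∀ {t} → a ∈ bag′ t → MeetsBag T J t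
      unmerged a∈t with origin a∈t
      ... | _ , x , x∈t , a≡ with collapse-spec x
      ...   | inj₁ (ix , _)  = x , inj₁ ix , x∈t
      ...   | inj₂ (_ , eq)  = x , inj₂ (sym (trans a≡ eq)) , x∈t

      uncollapsed : ∀ {t y} → y ≢ a → y ∈ bag′ t → y ∈ bag T t
      uncollapsed y≢a y∈t with origin y∈t
      ... | _ , x , x∈t , y≡ with collapse-spec x
      ...   | inj₁ (_ , eq) = ⊥-elim (y≢a (trans y≡ eq))
      ...   | inj₂ (_ , eq) = subst (_∈ bag T _) (sym (trans y≡ eq)) x∈t

      J⊆S : J ⊆ S
      J⊆S (inj₁ ix)   = I⊆S ix
      J⊆S (inj₂ refl) = S′⊆S S′a

      J-to-a : ∀ {x} → J x → Walk _∼_ J x a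
      J-to-a (inj₁ ix)   = to-a ix
      J-to-a (inj₂ refl) = here (inj₂ refl)

      coherent′ : ∀ y → ConnectedIn (tadj T) (λ t → y ∈ bag′ t)
      coherent′ y t t′ y∈t y∈t′ with y ≟ a
      ... | yes refl = weakenʷ merged (meetsBag-connected T J⊆S J-to-a t t′ (unmerged y∈t) (unmerged y∈t′))
      ... | no y≢a   = weakenʷ (λ y∈s → kept y∈s (proj₁ (origin y∈t)))
                               (coherent T y t t′ (uncollapsed y≢a y∈t) (uncollapsed y≢a y∈t′))

    td-contract : Σ (TD S′ w) λ T′ → ∀ {x v} → I x → S′ v → x ∼ v → ∃ λ t → a ∈ bag T′ t × v ∈ bag T′ t
    td-contract = T′ , neighbour-with-a
      where
        T′ : TD S′ w
        T′ = record
          { TreeDecomposition T using (m; tadj; isTree)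
          ; bag      = bag′
          ; bag⊆S    = λ t v v∈t → proj₁ (origin v∈t)
          ; vcover   = λ v s′v → let t , v∈t = vcover T v (S′⊆S s′v) in t , kept v∈t s′v
          ; ecover   = λ u v s′u s′v e → let t , u∈t , v∈t = ecover T u v (S′⊆S s′u) (S′⊆S s′v) e in
                                         t , kept u∈t s′u , kept v∈t s′v
          ; coherent = coherent′
          ; width    = λ t → ≤-trans (length-filter S′? (map collapse (bag T t)))
                                     (subst (_≤ suc w) (sym (length-map collapse (bag T t))) (width T t))
          }

        neighbour-with-a : ∀ {x v} → I x → S′ v → x ∼ v → ∃ λ t → a ∈ bag′ t × v ∈ bag′ t
        neighbour-with-a {x} {v} ix s′v e =
          let t , x∈t , v∈t = ecover T x v (I⊆S ix) (S′⊆S s′v) e in t , merged (x , inj₁ ix , x∈t) , kept v∈t s′v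

  -- Separators

  component-no-edge : ∀ {Sep A B : VSet G} → Component G Sep A → Component G Sep B →
                      (∀ {v} → A v → ¬ B v) → ∀ {u v} → A u → B v → ¬ u ∼ v
  component-no-edge compA compB disjoint {u} {v} au bv e =
    disjoint (closed compA u v au (outside compB v bv) e) bv

  td-glue-at-separator : ∀ {w} {Sep A B : VSet G} (T₁ : TD (Sep ∪ A) w) → BagContaining T₁ Sep →
                         (T₂ : TD (Sep ∪ B) w) → BagContaining T₂ Sep →
                         (∀ {v} → A v → ¬ B v) → (∀ {u v} → A u → B v → ¬ u ∼ v) →
                         Σ (TD (Sep ∪ (A ∪ B)) w) λ T → BagContaining T Sep
  td-glue-at-separator {Sep = Sep} {A} {B} T₁ (t₁ , Sep⊆t₁) T₂ (t₂ , Sep⊆t₂) disjoint no-edge =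
    let T , t , same-bag = td-glue T₁ T₂ t₁ t₂ shared no-crossing in
    td-cong T regroup ungroup , t , λ {v} sv → subst (v ∈_) (sym same-bag) (Sep⊆t₁ sv)
    where
      shared : ∀ {v} → (Sep ∪ A) v → (Sep ∪ B) v → v ∈ bag T₁ t₁ × v ∈ bag T₂ t₂
      shared (inj₁ sv) _          = Sep⊆t₁ sv , Sep⊆t₂ sv
      shared (inj₂ _)  (inj₁ sv)  = Sep⊆t₁ sv , Sep⊆t₂ sv
      shared (inj₂ av) (inj₂ bv)  = ⊥-elim (disjoint av bv)

      no-crossing : ∀ {u v} → (Sep ∪ A) u → (Sep ∪ B) v → u ∼ v → (Sep ∪ B) u ⊎ (Sep ∪ A) v
      no-crossing (inj₁ su) _         _ = inj₁ (inj₁ su)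
      no-crossing (inj₂ _)  (inj₁ sv) _ = inj₂ (inj₁ sv)
      no-crossing (inj₂ au) (inj₂ bv) e = ⊥-elim (no-edge au bv e)

      regroup : (Sep ∪ A) ∪ (Sep ∪ B) ⊆ Sep ∪ (A ∪ B)
      regroup = [ map₂ inj₁ , map₂ inj₂ ]′

      ungroup : Sep ∪ (A ∪ B) ⊆ (Sep ∪ A) ∪ (Sep ∪ B)
      ungroup = [ inj₁ ∘ inj₁ , [ inj₁ ∘ inj₂ , inj₂ ∘ inj₂ ]′ ]′

  td-glue-components : ∀ {k w} {Sep : VSet G} (C : Fin (suc k) → VSet G) →
                       (∀ i → Component G Sep (C i)) → (∀ i j → i ≢ j → ∀ v → C i v → ¬ C j v) →
                       (∀ i → Σ (TD (Sep ∪ C i) w) λ T → BagContaining T Sep) →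
                       Σ (TD (Sep ∪ (λ v → ∃ λ i → C i v)) w) λ T → BagContaining T Sep
  td-glue-components {zero} C _ _ Ts =
    let T , Sep-bag = Ts zero in
    td-cong T (map₂ (zero ,_)) (map₂ λ { (zero , c) → c }) , Sep-bag
  td-glue-components {suc k} {Sep = Sep} C comps disjoint Ts =
    let T₀ , Sep-bag₀ = Ts zero
        Tᵣ , Sep-bagᵣ = td-glue-components (C ∘ suc) (comps ∘ suc)
                          (λ i j i≢j → disjoint (suc i) (suc j) (i≢j ∘ suc-injective)) (Ts ∘ suc)
        T , Sep-bag = td-glue-at-separator T₀ Sep-bag₀ Tᵣ Sep-bagᵣ
                        (λ { {v} c₀ (i , c) → disjoint zero (suc i) (λ ()) v c₀ c })
                        (λ { c₀ (i , c) → component-no-edge (comps zero) (comps (suc i))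
                                            (λ {v} → disjoint zero (suc i) (λ ()) v) c₀ c })
    in td-cong T (map₂ [ (zero ,_) , (λ { (i , c) → suc i , c }) ]′)
                   (map₂ λ { (zero , c) → inj₁ c ; (suc i , c) → inj₂ (i , c) }) , Sep-bag

  Interior : ∀ {a b} → IPath G a b → VSet G
  Interior P x = ∃ λ i → Internal G P i × IPath.p P i ≡ x

  interior? : ∀ {a b} (P : IPath G a b) → Decidable (Interior P)
  interior? P x = any? λ i → ((0 <? toℕ i) ×-dec (toℕ i <? IPath.len P)) ×-dec (IPath.p P i ≟ x)

  consecutive : ∀ {a b} (P : IPath G a b) → ∀ i → IPath.p P (inject₁ i) ∼ IPath.p P (suc i)
  consecutive P i = proj₂ (IPath.induced P (inject₁ i) (suc i)) (inj₁ (cong suc (toℕ-inject₁ i)))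

  interior-to-start : ∀ {a b x} (P : IPath G a b) → Interior P x → Walk _∼_ (Interior P ∪ (_≡ a)) x a
  interior-to-start {a} P (i , (_ , i<len) , refl) =
    subst (Walk _∼_ _ (IPath.p P i)) (IPath.start P)
      (reverseʷ ∼-sym (weakenʷ on-prefix (walk-along (IPath.p P) (consecutive P) i)))
    where
      on-prefix : ∀ {x} → (∃ λ j → toℕ j ≤ toℕ i × IPath.p P j ≡ x) → (Interior P ∪ (_≡ a)) x
      on-prefix (zero  , _ , refl)   = inj₂ (IPath.start P)
      on-prefix (suc j , j≤i , refl) = inj₁ (suc j , (s≤s z≤n , ≤-<-trans j≤i i<len) , refl)

  penultimate : ∀ l (f : Fin (suc l) → V G) → (∀ i → f (inject₁ i) ∼ f (suc i)) →
                f zero ≢ f (fromℕ l) → ¬ f zero ∼ f (fromℕ l) →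
                ∃ λ i → (0 < toℕ i × toℕ i < l) × f i ∼ f (fromℕ l)
  penultimate zero          f adj distinct _       = ⊥-elim (distinct refl)
  penultimate (suc zero)    f adj _        ¬adj-ends = ⊥-elim (¬adj-ends (adj zero))
  penultimate (suc (suc l)) f adj _        _       =
    inject₁ (fromℕ (suc l)) , (s≤s z≤n , inject₁ℕ< (fromℕ (suc l))) , adj (fromℕ (suc l))

  last-interior : ∀ {a b} (P : IPath G a b) → a ≢ b → ¬ a ∼ b → ∃ λ x → Interior P x × x ∼ b
  last-interior {a} {b} P a≢b ¬a∼b
    with penultimate (IPath.len P) (IPath.p P) (consecutive P)
           (λ eq → a≢b (trans (sym (IPath.start P)) (trans eq (IPath.end P))))
           (λ e → ¬a∼b (subst₂ _∼_ (IPath.start P) (IPath.end P) e))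
  ... | i , internal , e = IPath.p P i , (i , internal , refl) , subst (_ ∼_) (IPath.end P) e

  -- Contracting the interior of Q onto a makes a and b share a bag.
  td-separator-side : ∀ {w a b} {Sep Z Z′ B : VSet G} → Decidable Sep → Decidable Z →
                      (T : TD B w) → Sep ∪ Z ⊆ B → (Q : IPath G a b) → VP G Q ⊆ B →
                      InternalIn G Q Z′ → (∀ {v} → (Sep ∪ Z) v → ¬ Z′ v) →
                      Sep a → Sep b → a ≢ b → ¬ a ∼ b →
                      (∀ {u v} → Sep u → Sep v → u ≢ v → u ∼ v ⊎ Pair a b u v) →
                      Σ (TD (Sep ∪ Z) w) λ T′ → BagContaining T′ Sep
  td-separator-side {w} {a} {b} {Sep} {Z} {Z′} Sep? Z? T side⊆B Q Q⊆B QZ′ side∩Z′=∅ Sa Sb a≢b ¬a∼b clique =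
    T′ , td-clique-bag T′ Sep? inj₁ pair-in-bag clique
    where
      contracted : Σ (TD (Sep ∪ Z) w) λ T′ →
                     ∀ {x v} → Interior Q x → (Sep ∪ Z) v → x ∼ v → ∃ λ t → a ∈ bag T′ t × v ∈ bag T′ t
      contracted = td-contract T (interior? Q) (λ v → Sep? v ⊎-dec Z? v) side⊆B
                     (λ { (i , _ , refl) → Q⊆B (i , refl) })
                     (λ { side (i , internal , refl) → side∩Z′=∅ side (QZ′ i internal) })
                     (inj₁ Sa) (interior-to-start Q)
      T′ : TD (Sep ∪ Z) w
      T′ = proj₁ contracted

      ab-bag : ∃ λ t → a ∈ bag T′ t × b ∈ bag T′ t
      ab-bag = let x , interior-x , x∼b = last-interior Q a≢b ¬a∼b in
               proj₂ contracted interior-x (inj₁ Sb) x∼b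

      pair-in-bag : ∀ {u v} → Pair a b u v → ∃ λ t → u ∈ bag T′ t × v ∈ bag T′ t
      pair-in-bag (inj₁ (refl , refl)) = ab-bag
      pair-in-bag (inj₂ (refl , refl)) = let t , a∈t , b∈t = ab-bag in t , b∈t , a∈t

  component? : ∀ {Sep X Y : VSet G} → ExactlyTwoComponents G Sep X Y → Decidable Sep → Decidable X
  component? ET Sep? v with Sep? v
  ... | yes sv = no λ xv → outside (compX ET) v xv sv
  ... | no ¬sv with cover ET v ¬sv
  ...   | inj₁ xv = yes xv
  ...   | inj₂ yv = no λ xv → disjoint ET v xv yv

  swap-components : ∀ {Sep X Y : VSet G} → ExactlyTwoComponents G Sep X Y → ExactlyTwoComponents G Sep Y X
  swap-components ET = record
    { compX    = compY ET
    ; compY    = compX ET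
    ; disjoint = λ v yv xv → disjoint ET v xv yv
    ; cover    = λ v ¬sv → swap (cover ET v ¬sv)
    }

  td-path-separator : ∀ {w a b} {Sep X Y B₀ B₁ : VSet G} → Decidable Sep → ExactlyTwoComponents G Sep X Y →
                      Sep a → Sep b → a ≢ b → ¬ a ∼ b →
                      (∀ {u v} → Sep u → Sep v → u ≢ v → u ∼ v ⊎ Pair a b u v) →
                      (P : IPath G a b) → InternalIn G P X → (Q : IPath G a b) → InternalIn G Q Y →
                      TD B₀ w → Sep ∪ X ⊆ B₀ → VP G Q ⊆ B₀ →
                      TD B₁ w → Sep ∪ Y ⊆ B₁ → VP G P ⊆ B₁ →
                      TD Everything w
  td-path-separator {w} {Sep = Sep} {X} {Y} Sep? ET Sa Sb a≢b ¬a∼b clique P PX Q QY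
                    T₀ X-side⊆B₀ Q⊆B₀ T₁ Y-side⊆B₁ P⊆B₁ =
    td-cong (proj₁ glued) (const tt) (λ {v} _ → everywhere v)
    where
      X? : Decidable X
      X? = component? ET Sep?

      Y? : Decidable Y
      Y? = component? (swap-components ET) Sep?

      X-side : Σ (TD (Sep ∪ X) w) λ T → BagContaining T Sep
      X-side = td-separator-side Sep? X? T₀ X-side⊆B₀ Q Q⊆B₀ QY
                 (λ { (inj₁ sv) yv → outside (compY ET) _ yv sv ; (inj₂ xv) yv → disjoint ET _ xv yv })
                 Sa Sb a≢b ¬a∼b clique
      Y-side : Σ (TD (Sep ∪ Y) w) λ T → BagContaining T Sep
      Y-side = td-separator-side Sep? Y? T₁ Y-side⊆B₁ P P⊆B₁ PX
                 (λ { (inj₁ sv) xv → outside (compX ET) _ xv sv ; (inj₂ yv) xv → disjoint ET _ xv yv })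
                 Sa Sb a≢b ¬a∼b clique

      glued : Σ (TD (Sep ∪ (X ∪ Y)) w) λ T → BagContaining T Sep
      glued = td-glue-at-separator (proj₁ X-side) (proj₂ X-side) (proj₁ Y-side) (proj₂ Y-side)
                (λ {v} → disjoint ET v) (component-no-edge (compX ET) (compY ET) (λ {v} → disjoint ET v))

      everywhere : ∀ v → (Sep ∪ (X ∪ Y)) v
      everywhere v with Sep? v
      ... | yes sv = inj₁ sv
      ... | no ¬sv = inj₂ (cover ET v ¬sv)

  td-clique-separator : ∀ {k w} {K : VSet G} → Decidable K → Clique G K → (C : Fin (suc k) → VSet G) →
                        (∀ i → Component G K (C i)) → (∀ i j → i ≢ j → ∀ v → C i v → ¬ C j v) →
                        (∀ v → ¬ K v → ∃ λ i → C i v) → (∀ i → TD (K ∪ C i) w) → TD Everything w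
  td-clique-separator {w = w} {K} K? clique C comps disjoint cover Ts =
    td-cong (proj₁ glued) (const tt) (λ {v} _ → everywhere v)
    where
      glued : Σ (TD (K ∪ (λ v → ∃ λ i → C i v)) w) λ T → BagContaining T K
      glued = td-glue-components C comps disjoint
                (λ i → Ts i , td-clique-bag {F = λ _ _ → ⊥} (Ts i) K? inj₁ (λ ())
                                (λ ku kv u≢v → inj₁ (clique _ _ ku kv u≢v)))

      everywhere : ∀ v → (K ∪ (λ v → ∃ λ i → C i v)) v
      everywhere v with K? v
      ... | yes kv = inj₁ kv
      ... | no ¬kv = inj₂ (cover v ¬kv)

  two-clique : ∀ {a b u v} → (u ≡ a ⊎ u ≡ b) → (v ≡ a ⊎ v ≡ b) → u ≢ v → u ∼ v ⊎ Pair a b u v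
  two-clique (inj₁ refl) (inj₁ refl) u≢v = ⊥-elim (u≢v refl)
  two-clique (inj₁ refl) (inj₂ refl) _   = inj₂ (inj₁ (refl , refl))
  two-clique (inj₂ refl) (inj₁ refl) _   = inj₂ (inj₂ (refl , refl))
  two-clique (inj₂ refl) (inj₂ refl) u≢v = ⊥-elim (u≢v refl)

  three-clique : ∀ {a c b u v} → a ∼ c → c ∼ b → (u ≡ a ⊎ u ≡ c ⊎ u ≡ b) → (v ≡ a ⊎ v ≡ c ⊎ v ≡ b) →
                 u ≢ v → u ∼ v ⊎ Pair a b u v
  three-clique a∼c c∼b (inj₁ refl)        (inj₂ (inj₁ refl)) _ = inj₁ a∼c
  three-clique a∼c c∼b (inj₂ (inj₁ refl)) (inj₁ refl)        _ = inj₁ (∼-sym a∼c)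
  three-clique a∼c c∼b (inj₂ (inj₁ refl)) (inj₂ (inj₂ refl)) _ = inj₁ c∼b
  three-clique a∼c c∼b (inj₂ (inj₂ refl)) (inj₂ (inj₁ refl)) _ = inj₁ (∼-sym c∼b)
  three-clique a∼c c∼b (inj₁ refl)        (inj₂ (inj₂ refl)) _ = inj₂ (inj₁ (refl , refl))
  three-clique a∼c c∼b (inj₂ (inj₂ refl)) (inj₁ refl)        _ = inj₂ (inj₂ (refl , refl))
  three-clique a∼c c∼b (inj₁ refl)        (inj₁ refl)        u≢v = ⊥-elim (u≢v refl)
  three-clique a∼c c∼b (inj₂ (inj₁ refl)) (inj₂ (inj₁ refl)) u≢v = ⊥-elim (u≢v refl)
  three-clique a∼c c∼b (inj₂ (inj₂ refl)) (inj₂ (inj₂ refl)) u≢v = ⊥-elim (u≢v refl)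

  td-decomposition : ∀ {k B w} → Decomposition G k B → (∀ i → TreeDecomposition G (B i) w) →
                     TreeDecomposition G Everything w
  td-decomposition (cliqueSep K clique (suc (suc k)) _ C comps disjoint cover) Ts =
    td-clique-separator K? clique C comps disjoint cover Ts
    where
      K? : Decidable K
      K? = shared-part? (λ {v} → disjoint zero (suc zero) (λ ()) v) (td-dec (Ts zero)) (td-dec (Ts (suc zero)))
  td-decomposition (cliqueSep _ _ (suc zero) (s≤s ()) _ _ _ _) _
  td-decomposition (twoSep a b a≢b ¬a∼b X Y ET _ _ _ _ P PX Q QY) Ts =
    td-path-separator (λ v → (v ≟ a) ⊎-dec (v ≟ b)) ET (inj₁ refl) (inj₂ refl) a≢b ¬a∼b two-clique
      P PX Q QY
      (Ts zero)       [ inj₂ ∘ map₂ inj₁ , inj₁ ]′               (inj₂ ∘ inj₂ ∘ inj₂)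
      (Ts (suc zero)) [ inj₂ ∘ map₂ inj₁ , inj₂ ∘ inj₂ ∘ inj₂ ]′ inj₁
  td-decomposition (p3Sep a c b a∼c c∼b ¬a∼b a≢b X Y ET _ _ _ _ _ _ _ _ P PX _ Q QY) Ts =
    td-path-separator (λ v → (v ≟ a) ⊎-dec ((v ≟ c) ⊎-dec (v ≟ b))) ET (inj₁ refl) (inj₂ (inj₂ refl))
      a≢b ¬a∼b (three-clique a∼c c∼b)
      P PX Q QY
      (Ts zero)       [ inj₂ ∘ map₂ (map₂ inj₁) , inj₁ ]′                      (inj₂ ∘ inj₂ ∘ inj₂ ∘ inj₂)
      (Ts (suc zero)) [ inj₂ ∘ map₂ (map₂ inj₁) , inj₂ ∘ inj₂ ∘ inj₂ ∘ inj₂ ]′ inj₁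

maxF-lub : ∀ k (f : Fin k → ℕ) {w} → (∀ i → f i ≤ w) → maxF k f ≤ w
maxF-lub zero    f bound = z≤n
maxF-lub (suc k) f bound = ⊔-lub (bound zero) (maxF-lub k (f ∘ suc) (bound ∘ suc))

maxF-ub : ∀ k (f : Fin k → ℕ) i → f i ≤ maxF k f
maxF-ub (suc k) f zero    = m≤m⊔n _ _
maxF-ub (suc k) f (suc i) = ≤-trans (maxF-ub k (f ∘ suc) i) (m≤n⊔m (f zero) _)

lemmal : (G : Graph) (k : ℕ) (B : Fin k → VSet G) →
         Decomposition G k B →
         (ts : Fin k → ℕ) → (∀ i → TW G (B i) (ts i)) →
         TW G (Everything {V G}) (maxF k ts)
lemmal G k B D ts tws = upper , lower
  where
    upper : TreeDecomposition G Everything (maxF k ts)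
    upper = td-decomposition G D λ i → td-widen G (proj₁ (tws i)) (maxF-ub k ts i)

    lower : ∀ w → TreeDecomposition G Everything w → maxF k ts ≤ w
    lower w T = maxF-lub k ts λ i → proj₂ (tws i) w (td-restrict G T (td-dec G (proj₁ (tws i))) (const tt))
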